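{- Let $n\ge 0$ and $k\ge 1$ be integers, and let $T$ be the triangle with vertices $(L_n,L_{n+k})$, $(L_{n+2k},L_{n+3k})$, $(L_{n+4k},L_{n+5k})$. Then the area of $T$ equals $\dfrac{25}{2}F_k^4L_k$ if $k$ is even, and $\dfrac{5F_k^2L_k^3}{2}$ if $k$ is odd.
   Context: $F_n$ denotes the Fibonacci numbers ($F_0=0$, $F_1=1$, $F_{n+1}=F_n+F_{n-1}$) and $L_n$ the Lucas numbers ($L_0=2$, $L_1=1$, $L_{n+1}=L_n+L_{n-1}$). The area of the triangle with vertices $(x_1,y_1),(x_2,y_2),(x_3,y_3)$ is $\frac12\left|(x_2-x_1)(y_3-y_1)-(x_3-x_1)(y_2-y_1)\right|$. -}

module Defs where

open import Data.Nat using (ℕ; zero; suc; _+_)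
open import Data.Integer using (ℤ; +_; ∣_∣) renaming (_+_ to _+ℤ_; _*_ to _*ℤ_; _-_ to _-ℤ_)
open import Data.Product using (_×_; _,_)

F : ℕ → ℕ
F zero = 0
F (suc zero) = 1
F (suc (suc n)) = F (suc n) + F n

L : ℕ → ℕ
L zero = 2
L (suc zero) = 1
L (suc (suc n)) = L (suc n) + L n

Point : Set
Point = ℤ × ℤ

doubleArea : Point → Point → Point → ℕ
doubleArea (x1 , y1) (x2 , y2) (x3 , y3) =
  ∣ ((x2 -ℤ x1) *ℤ (y3 -ℤ y1)) -ℤ ((x3 -ℤ x1) *ℤ (y2 -ℤ y1)) ∣

module Submission where

-- Every sequence G with the Fibonacci recurrence, sampled with stride k, satisfies the
-- second-order recurrence a (i+2) = L k * a (i+1) - (-1)^k * a i.  For any recurrence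
-- a (i+2) = c a (i+1) - e a i the determinant of the triangle (a0,a1), (a2,a3), (a4,a5) is
-- c (c² - (1+e)²) (a1² - c a0 a1 + e a0²), and for the stride-k samples of G the quadratic
-- factor is F k² times the Cassini form G (n+1)² - G n G (n+1) - G n², which for the Lucas
-- numbers is -5 (-1)^n.  The parity of k fixes e = ±1, and L k² = 5 F k² + 4 (-1)^k gives the
-- two closed forms.

open import Defs
open import Data.Nat.Base as ℕ using (ℕ; zero; suc; _%_; _/_)
import Data.Nat.Properties as ℕₚ
open import Data.Nat.DivMod using (m≡m%n+[m/n]*n)
open import Data.Product using (_,_)
open import Relation.Binary.PropositionalEquality
  using (_≡_; refl; sym; trans; cong; cong₂; module ≡-Reasoning)

module FibonacciLike where

  open import Data.Integer.Base using (ℤ; +_; -_; _+_; _-_; _*_; _^_; 1ℤ; -1ℤ; ∣_∣)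
  open import Data.Integer.Properties
    using (pos-+; pos-*; abs-*; -1*i≡-i; *-assoc; *-identityˡ; *-identityʳ;
           ^-distribˡ-+-*; ^-*-assoc; ^-zeroˡ)
  open import Data.Integer.Tactic.RingSolver using (solve-∀)
  open ≡-Reasoning

  record IsFibonacciLike (G : ℕ → ℤ) : Set where
    field recurrence : ∀ m → G (suc (suc m)) ≡ G (suc m) + G m

  Fℤ Lℤ : ℕ → ℤ
  Fℤ m = + F m
  Lℤ m = + L m

  F-isFibonacciLike : IsFibonacciLike Fℤ
  F-isFibonacciLike = record { recurrence = λ m → pos-+ (F (suc m)) (F m) }

  L-isFibonacciLike : IsFibonacciLike Lℤ
  L-isFibonacciLike = record { recurrence = λ m → pos-+ (L (suc m)) (L m) }

  cassiniForm : (ℕ → ℤ) → ℕ → ℤ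
  cassiniForm G m = G (suc m) * G (suc m) - G m * G (suc m) - G m * G m

  module _ {G : ℕ → ℤ} (isFib : IsFibonacciLike G) where

    open IsFibonacciLike isFib

    -- Fℤ (suc k) - Fℤ k plays the role of F (k - 1), which keeps the formula valid at k = 0.
    addition : ∀ m k →
               G (m ℕ.+ k) ≡ Fℤ k * G (suc m) + (Fℤ (suc k) - Fℤ k) * G m
    addition m zero = trans (cong G (ℕₚ.+-identityʳ m)) (base (G m) (G (suc m)))
      where
      base : ∀ x y → x ≡ + 0 * y + (+ 1 - + 0) * x
      base = solve-∀
    addition m (suc k) = begin
      G (m ℕ.+ suc k)
        ≡⟨ cong G (ℕₚ.+-suc m k) ⟩
      G (suc m ℕ.+ k)
        ≡⟨ addition (suc m) k ⟩
      f * G (suc (suc m)) + (f′ - f) * G (suc m)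
        ≡⟨ cong (λ t → f * t + (f′ - f) * G (suc m)) (recurrence m) ⟩
      f * (G (suc m) + G m) + (f′ - f) * G (suc m)
        ≡⟨ regroup f f′ (G m) (G (suc m)) ⟩
      f′ * G (suc m) + ((f′ + f) - f′) * G m
        ≡⟨ cong (λ t → f′ * G (suc m) + (t - f′) * G m) (pos-+ (F (suc k)) (F k)) ⟨
      Fℤ (suc k) * G (suc m) + (Fℤ (suc (suc k)) - Fℤ (suc k)) * G m
        ∎
      where
      f f′ : ℤ
      f = Fℤ k
      f′ = Fℤ (suc k)
      regroup : ∀ f f′ x y → f * (y + x) + (f′ - f) * y ≡ f′ * y + ((f′ + f) - f′) * x
      regroup = solve-∀

    cassiniForm-suc : ∀ m → cassiniForm G (suc m) ≡ - cassiniForm G m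
    cassiniForm-suc m = begin
      cassiniForm G (suc m)
        ≡⟨ cong (λ t → t * t - G (suc m) * t - G (suc m) * G (suc m)) (recurrence m) ⟩
      (y + x) * (y + x) - y * (y + x) - y * y
        ≡⟨ flip x y ⟩
      - cassiniForm G m
        ∎
      where
      x y : ℤ
      x = G m
      y = G (suc m)
      flip : ∀ x y → (y + x) * (y + x) - y * (y + x) - y * y ≡ - (y * y - x * y - x * x)
      flip = solve-∀

    cassini : ∀ m → cassiniForm G m ≡ -1ℤ ^ m * cassiniForm G 0
    cassini zero = sym (*-identityˡ (cassiniForm G 0))
    cassini (suc m) = begin
      cassiniForm G (suc m)          ≡⟨ cassiniForm-suc m ⟩
      - cassiniForm G m              ≡⟨ cong -_ (cassini m) ⟩
      - (-1ℤ ^ m * cassiniForm G 0)  ≡⟨ -1*i≡-i _ ⟨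
      -1ℤ * (-1ℤ ^ m * cassiniForm G 0) ≡⟨ *-assoc -1ℤ (-1ℤ ^ m) _ ⟨
      -1ℤ ^ suc m * cassiniForm G 0  ∎

  L≡2F[1+k]-F : ∀ k → Lℤ k ≡ + 2 * Fℤ (suc k) - Fℤ k
  L≡2F[1+k]-F k = trans (addition L-isFibonacciLike 0 k) (regroup (Fℤ k) (Fℤ (suc k)))
    where
    regroup : ∀ f f′ → f * + 1 + (f′ - f) * + 2 ≡ + 2 * f′ - f
    regroup = solve-∀

  cassini-F : ∀ k → cassiniForm Fℤ k ≡ -1ℤ ^ k
  cassini-F k = trans (cassini F-isFibonacciLike k) (*-identityʳ (-1ℤ ^ k))

  L²≡5F²+4[-1^k] : ∀ k → Lℤ k * Lℤ k ≡ + 5 * (Fℤ k * Fℤ k) + + 4 * -1ℤ ^ k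
  L²≡5F²+4[-1^k] k = begin
    Lℤ k * Lℤ k
      ≡⟨ cong (λ t → t * t) (L≡2F[1+k]-F k) ⟩
    (+ 2 * f′ - f) * (+ 2 * f′ - f)
      ≡⟨ expand f f′ ⟩
    + 5 * (f * f) + + 4 * cassiniForm Fℤ k
      ≡⟨ cong (λ t → + 5 * (f * f) + + 4 * t) (cassini-F k) ⟩
    + 5 * (f * f) + + 4 * -1ℤ ^ k
      ∎
    where
    f f′ : ℤ
    f = Fℤ k
    f′ = Fℤ (suc k)
    expand : ∀ f f′ → (+ 2 * f′ - f) * (+ 2 * f′ - f) ≡ + 5 * (f * f) + + 4 * (f′ * f′ - f * f′ - f * f)
    expand = solve-∀

  module _ {G : ℕ → ℤ} (isFib : IsFibonacciLike G) where

    open IsFibonacciLike isFib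

    stride-recurrence : ∀ m k → G (m ℕ.+ k ℕ.+ k) ≡ Lℤ k * G (m ℕ.+ k) - -1ℤ ^ k * G m
    stride-recurrence m k = begin
      G (m ℕ.+ k ℕ.+ k)
        ≡⟨ addition isFib (m ℕ.+ k) k ⟩
      f * G (suc m ℕ.+ k) + g * G (m ℕ.+ k)
        ≡⟨ cong₂ (λ a b → f * a + g * b) (addition isFib (suc m) k) (addition isFib m k) ⟩
      f * (f * G (suc (suc m)) + g * y) + g * (f * y + g * x)
        ≡⟨ cong (λ t → f * (f * t + g * y) + g * (f * y + g * x)) (recurrence m) ⟩
      f * (f * (y + x) + g * y) + g * (f * y + g * x)
        ≡⟨ regroup f f′ x y ⟩
      (+ 2 * f′ - f) * (f * y + g * x) - cassiniForm Fℤ k * x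
        ≡⟨ cong₂ (λ a b → a * (f * y + g * x) - b * x) (L≡2F[1+k]-F k) (sym (cassini-F k)) ⟨
      Lℤ k * (f * y + g * x) - -1ℤ ^ k * x
        ≡⟨ cong (λ t → Lℤ k * t - -1ℤ ^ k * x) (addition isFib m k) ⟨
      Lℤ k * G (m ℕ.+ k) - -1ℤ ^ k * G m
        ∎
      where
      f f′ g x y : ℤ
      f = Fℤ k
      f′ = Fℤ (suc k)
      g = f′ - f
      x = G m
      y = G (suc m)
      regroup : ∀ f f′ x y →
        f * (f * (y + x) + (f′ - f) * y) + (f′ - f) * (f * y + (f′ - f) * x)
          ≡ (+ 2 * f′ - f) * (f * y + (f′ - f) * x) - (f′ * f′ - f * f′ - f * f) * x
      regroup = solve-∀

    stride-cassiniForm : ∀ m k →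
      G (m ℕ.+ k) * G (m ℕ.+ k) - Lℤ k * G m * G (m ℕ.+ k) + -1ℤ ^ k * G m * G m
        ≡ Fℤ k * Fℤ k * cassiniForm G m
    stride-cassiniForm m k = begin
      G (m ℕ.+ k) * G (m ℕ.+ k) - Lℤ k * x * G (m ℕ.+ k) + -1ℤ ^ k * x * x
        ≡⟨ cong (λ t → t * t - Lℤ k * x * t + -1ℤ ^ k * x * x) (addition isFib m k) ⟩
      a * a - Lℤ k * x * a + -1ℤ ^ k * x * x
        ≡⟨ cong₂ (λ c e → a * a - c * x * a + e * x * x) (L≡2F[1+k]-F k) (sym (cassini-F k)) ⟩
      a * a - (+ 2 * f′ - f) * x * a + cassiniForm Fℤ k * x * x
        ≡⟨ factor f f′ x y ⟩
      f * f * cassiniForm G m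
        ∎
      where
      f f′ x y a : ℤ
      f = Fℤ k
      f′ = Fℤ (suc k)
      x = G m
      y = G (suc m)
      a = f * y + (f′ - f) * x
      factor : ∀ f f′ x y → let a = f * y + (f′ - f) * x in
        a * a - (+ 2 * f′ - f) * x * a + (f′ * f′ - f * f′ - f * f) * x * x
          ≡ f * f * (y * y - x * y - x * x)
      factor = solve-∀

  signedDoubleArea : Point → Point → Point → ℤ
  signedDoubleArea (x1 , y1) (x2 , y2) (x3 , y3) = (x2 - x1) * (y3 - y1) - (x3 - x1) * (y2 - y1)

  signedDoubleArea-recurrence : ∀ {a0 a1 a2 a3 a4 a5} c e →
    a2 ≡ c * a1 - e * a0 → a3 ≡ c * a2 - e * a1 → a4 ≡ c * a3 - e * a2 → a5 ≡ c * a4 - e * a3 →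
    signedDoubleArea (a0 , a1) (a2 , a3) (a4 , a5)
      ≡ c * (c * c - (1ℤ + e) * (1ℤ + e)) * (a1 * a1 - c * a0 * a1 + e * a0 * a0)
  signedDoubleArea-recurrence {a0} {a1} c e refl refl refl refl = expand a0 a1 c e
    where
    expand : ∀ a0 a1 c e →
      let a2 = c * a1 - e * a0
          a3 = c * a2 - e * a1
          a4 = c * a3 - e * a2
          a5 = c * a4 - e * a3
      in (a2 - a0) * (a5 - a1) - (a4 - a0) * (a3 - a1)
           ≡ c * (c * c - (1ℤ + e) * (1ℤ + e)) * (a1 * a1 - c * a0 * a1 + e * a0 * a0)
    expand = solve-∀

  strideArea : (ℕ → ℤ) → ℕ → ℕ → ℤ
  strideArea G n k =
    signedDoubleArea (G n , G (n ℕ.+ k))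
                     (G (n ℕ.+ 2 ℕ.* k) , G (n ℕ.+ 3 ℕ.* k))
                     (G (n ℕ.+ 4 ℕ.* k) , G (n ℕ.+ 5 ℕ.* k))

  strideArea-formula : ∀ {G} → IsFibonacciLike G → ∀ n k →
    strideArea G n k
      ≡ Lℤ k * (Lℤ k * Lℤ k - (1ℤ + -1ℤ ^ k) * (1ℤ + -1ℤ ^ k)) * (Fℤ k * Fℤ k * cassiniForm G n)
  strideArea-formula {G} isFib n k = begin
    strideArea G n k
      ≡⟨ signedDoubleArea-recurrence (Lℤ k) (-1ℤ ^ k)
           (step refl twice) (step twice (next 2)) (step (next 2) (next 3)) (step (next 3) (next 4)) ⟩
    Lℤ k * (Lℤ k * Lℤ k - (1ℤ + -1ℤ ^ k) * (1ℤ + -1ℤ ^ k))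
      * (G (n ℕ.+ k) * G (n ℕ.+ k) - Lℤ k * G n * G (n ℕ.+ k) + -1ℤ ^ k * G n * G n)
      ≡⟨ cong (Lℤ k * (Lℤ k * Lℤ k - (1ℤ + -1ℤ ^ k) * (1ℤ + -1ℤ ^ k)) *_) (stride-cassiniForm isFib n k) ⟩
    Lℤ k * (Lℤ k * Lℤ k - (1ℤ + -1ℤ ^ k) * (1ℤ + -1ℤ ^ k)) * (Fℤ k * Fℤ k * cassiniForm G n)
      ∎
    where
    step : ∀ {i j l} → j ≡ i ℕ.+ k → l ≡ j ℕ.+ k → G l ≡ Lℤ k * G j - -1ℤ ^ k * G i
    step refl refl = stride-recurrence isFib _ k
    next : ∀ i → n ℕ.+ suc i ℕ.* k ≡ n ℕ.+ i ℕ.* k ℕ.+ k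
    next i = trans (cong (n ℕ.+_) (ℕₚ.+-comm k (i ℕ.* k))) (sym (ℕₚ.+-assoc n (i ℕ.* k) k))
    twice : n ℕ.+ 2 ℕ.* k ≡ n ℕ.+ k ℕ.+ k
    twice = trans (next 1) (cong (λ t → n ℕ.+ t ℕ.+ k) (ℕₚ.*-identityˡ k))

  -1^k≡-1^[k%2] : ∀ k → -1ℤ ^ k ≡ -1ℤ ^ (k % 2)
  -1^k≡-1^[k%2] k = begin
    -1ℤ ^ k                              ≡⟨ cong (-1ℤ ^_) (m≡m%n+[m/n]*n k 2) ⟩
    -1ℤ ^ (k % 2 ℕ.+ k / 2 ℕ.* 2)        ≡⟨ ^-distribˡ-+-* -1ℤ (k % 2) (k / 2 ℕ.* 2) ⟩
    -1ℤ ^ (k % 2) * -1ℤ ^ (k / 2 ℕ.* 2)  ≡⟨ cong (-1ℤ ^ (k % 2) *_) (-1^[q*2]≡1 (k / 2)) ⟩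
    -1ℤ ^ (k % 2) * 1ℤ                   ≡⟨ *-identityʳ (-1ℤ ^ (k % 2)) ⟩
    -1ℤ ^ (k % 2)                        ∎
    where
    -1^[q*2]≡1 : ∀ q → -1ℤ ^ (q ℕ.* 2) ≡ 1ℤ
    -1^[q*2]≡1 q = trans (cong (-1ℤ ^_) (ℕₚ.*-comm q 2)) (trans (sym (^-*-assoc -1ℤ 2 q)) (^-zeroˡ q))

  ∣-1^j*+m∣≡m : ∀ j m → ∣ -1ℤ ^ j * + m ∣ ≡ m
  ∣-1^j*+m∣≡m j m = trans (abs-* (-1ℤ ^ j) (+ m)) (trans (cong (ℕ._* m) (∣-1^j∣≡1 j)) (ℕₚ.*-identityˡ m))
    where
    ∣-1^j∣≡1 : ∀ j → ∣ -1ℤ ^ j ∣ ≡ 1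
    ∣-1^j∣≡1 zero = refl
    ∣-1^j∣≡1 (suc j) = trans (abs-* -1ℤ (-1ℤ ^ j)) (trans (ℕₚ.*-identityˡ _) (∣-1^j∣≡1 j))

  pos-^ : ∀ m j → + (m ℕ.^ j) ≡ (+ m) ^ j
  pos-^ m zero = refl
  pos-^ m (suc j) = trans (pos-* m (m ℕ.^ j)) (cong (+ m *_) (pos-^ m j))

  strideArea-L : ∀ n k →
    strideArea Lℤ n k ≡ -1ℤ ^ suc n * (+ 5 * (Fℤ k * Fℤ k) * Lℤ k * (Lℤ k * Lℤ k - (1ℤ + -1ℤ ^ k) * (1ℤ + -1ℤ ^ k)))
  strideArea-L n k = begin
    strideArea Lℤ n k
      ≡⟨ strideArea-formula L-isFibonacciLike n k ⟩
    l * (l * l - (1ℤ + e) * (1ℤ + e)) * (f * f * cassiniForm Lℤ n)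
      ≡⟨ cong (λ t → l * (l * l - (1ℤ + e) * (1ℤ + e)) * (f * f * t)) (cassini L-isFibonacciLike n) ⟩
    l * (l * l - (1ℤ + e) * (1ℤ + e)) * (f * f * (-1ℤ ^ n * - + 5))
      ≡⟨ regroup f l e (-1ℤ ^ n) ⟩
    -1ℤ ^ suc n * (+ 5 * (f * f) * l * (l * l - (1ℤ + e) * (1ℤ + e)))
      ∎
    where
    f l e : ℤ
    f = Fℤ k
    l = Lℤ k
    e = -1ℤ ^ k
    regroup : ∀ f l e s →
      l * (l * l - (1ℤ + e) * (1ℤ + e)) * (f * f * (s * - + 5))
        ≡ -1ℤ * s * (+ 5 * (f * f) * l * (l * l - (1ℤ + e) * (1ℤ + e)))
    regroup = solve-∀

  -- The right-hand sides of the `regroup` identities are f ^ 4, f ^ 2 and l ^ 3 unfolded: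
  -- the ring solver does not read _^_, but the unfolded forms are definitionally equal.
  strideArea-L-even : ∀ n k → k % 2 ≡ 0 → strideArea Lℤ n k ≡ -1ℤ ^ suc n * + (25 ℕ.* F k ℕ.^ 4 ℕ.* L k)
  strideArea-L-even n k even = trans (strideArea-L n k) (cong (-1ℤ ^ suc n *_) (begin
    + 5 * (f * f) * l * (l * l - (1ℤ + e) * (1ℤ + e))
      ≡⟨ cong (λ t → + 5 * (f * f) * l * (t - (1ℤ + e) * (1ℤ + e))) (L²≡5F²+4[-1^k] k) ⟩
    + 5 * (f * f) * l * (+ 5 * (f * f) + + 4 * e - (1ℤ + e) * (1ℤ + e))
      ≡⟨ cong (λ t → + 5 * (f * f) * l * (+ 5 * (f * f) + + 4 * t - (1ℤ + t) * (1ℤ + t)))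
              (trans (-1^k≡-1^[k%2] k) (cong (-1ℤ ^_) even)) ⟩
    + 5 * (f * f) * l * (+ 5 * (f * f) + + 4 * 1ℤ - (1ℤ + 1ℤ) * (1ℤ + 1ℤ))
      ≡⟨ regroup f l ⟩
    + 25 * f ^ 4 * l
      ≡⟨ cong (_* l) (trans (pos-* 25 (F k ℕ.^ 4)) (cong (+ 25 *_) (pos-^ (F k) 4))) ⟨
    + (25 ℕ.* F k ℕ.^ 4) * l
      ≡⟨ pos-* (25 ℕ.* F k ℕ.^ 4) (L k) ⟨
    + (25 ℕ.* F k ℕ.^ 4 ℕ.* L k)
      ∎))
    where
    f l e : ℤ
    f = Fℤ k
    l = Lℤ k
    e = -1ℤ ^ k
    regroup : ∀ f l →
      + 5 * (f * f) * l * (+ 5 * (f * f) + + 4 * 1ℤ - (1ℤ + 1ℤ) * (1ℤ + 1ℤ))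
        ≡ + 25 * (f * (f * (f * (f * 1ℤ)))) * l
    regroup = solve-∀

  strideArea-L-odd : ∀ n k → k % 2 ≡ 1 → strideArea Lℤ n k ≡ -1ℤ ^ suc n * + (5 ℕ.* F k ℕ.^ 2 ℕ.* L k ℕ.^ 3)
  strideArea-L-odd n k odd = trans (strideArea-L n k) (cong (-1ℤ ^ suc n *_) (begin
    + 5 * (f * f) * l * (l * l - (1ℤ + e) * (1ℤ + e))
      ≡⟨ cong (λ t → + 5 * (f * f) * l * (l * l - (1ℤ + t) * (1ℤ + t)))
              (trans (-1^k≡-1^[k%2] k) (cong (-1ℤ ^_) odd)) ⟩
    + 5 * (f * f) * l * (l * l - (1ℤ + -1ℤ) * (1ℤ + -1ℤ))
      ≡⟨ regroup f l ⟩
    + 5 * f ^ 2 * l ^ 3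
      ≡⟨ cong₂ _*_ (trans (pos-* 5 (F k ℕ.^ 2)) (cong (+ 5 *_) (pos-^ (F k) 2))) (pos-^ (L k) 3) ⟨
    + (5 ℕ.* F k ℕ.^ 2) * + (L k ℕ.^ 3)
      ≡⟨ pos-* (5 ℕ.* F k ℕ.^ 2) (L k ℕ.^ 3) ⟨
    + (5 ℕ.* F k ℕ.^ 2 ℕ.* L k ℕ.^ 3)
      ∎))
    where
    f l e : ℤ
    f = Fℤ k
    l = Lℤ k
    e = -1ℤ ^ k
    regroup : ∀ f l →
      + 5 * (f * f) * l * (l * l - (1ℤ + -1ℤ) * (1ℤ + -1ℤ))
        ≡ + 5 * (f * (f * 1ℤ)) * (l * (l * (l * 1ℤ)))
    regroup = solve-∀

open FibonacciLike using (strideArea-L-even; strideArea-L-odd; ∣-1^j*+m∣≡m)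

open import Data.Nat using (ℕ; _+_; _*_; _^_; _≥_)
open import Data.Integer using (+_; ∣_∣)
open import Data.Product using (_×_)

theorem2p3 : (n k : ℕ) → k ≥ 1 →
    ((k % 2 ≡ 0) → doubleArea (+ L n , + L (n + k)) (+ L (n + 2 * k) , + L (n + 3 * k)) (+ L (n + 4 * k) , + L (n + 5 * k)) ≡ 25 * (F k ^ 4) * L k)
    × ((k % 2 ≡ 1) → doubleArea (+ L n , + L (n + k)) (+ L (n + 2 * k) , + L (n + 3 * k)) (+ L (n + 4 * k) , + L (n + 5 * k)) ≡ 5 * (F k ^ 2) * (L k ^ 3))
theorem2p3 n k _ =
    (λ even → trans (cong ∣_∣ (strideArea-L-even n k even)) (∣-1^j*+m∣≡m (suc n) _))
  , (λ odd → trans (cong ∣_∣ (strideArea-L-odd n k odd)) (∣-1^j*+m∣≡m (suc n) _))
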